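{- Let $m\ge n\ge 2$. Then \[EX_n^m=\mathrm{conv}\left(\{\pi_n(p_T): T\in RB_U(m)\}\right).\]
   Context: For $k\ge 2$, $RB_L(k)$ denotes the set of rooted binary trees (every non-leaf vertex has exactly two unordered children) with $k$ leaves labelled bijectively by $[k]$, up to label-preserving isomorphism, and $RB_U(k)$ the set of unlabelled rooted binary trees (tree shapes) with $k$ leaves. For $T\in RB_U(k)$, $O(T)$ is the set of labelled trees in $RB_L(k)$ whose shape is $T$, and $p_T$ is the distribution on $RB_L(k)$ that is uniform on $O(T)$ and zero elsewhere. For a rooted binary tree $Q$ and a set $S$ of its leaves, $Q|_S$ is the restriction tree: vertices are the elements of $S$ and the lowest common ancestors of pairs of elements of $S$, with ancestry inherited from $Q$. A distribution on $RB_L(k)$ is exchangeable if it is invariant under permuting leaf labels; $EX_k$ is the set of exchangeable distributions. For $m\ge n$ and a distribution $p_m$ on $RB_L(m)$, $\pi_n(p_m)(T)=\sum_{\{S\in RB_L(m): S|_{[n]}=T\}}p_m(S)$ for $T\in RB_L(n)$, and $EX_n^m=\pi_n(EX_m)$. $\mathrm{conv}$ denotes convex hull in $\mathbb{R}^{RB_L(n)}$. -}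

module Defs where

open import Level using (Level; _⊔_) renaming (suc to lsuc)
open import Data.Nat using (ℕ; _<?_)
open import Data.Fin using (Fin; toℕ; fromℕ<)
import Data.Fin as Fin
open import Data.Fin.Permutation using (Permutation′; _⟨$⟩ʳ_)
open import Data.Unit using (⊤; tt)
open import Data.Bool using (Bool; true; false; if_then_else_)
open import Data.Maybe using (Maybe; just; nothing)
open import Data.Maybe.Properties using () renaming (≡-dec to ≡-decMaybe)
open import Data.List using (List; []; _∷_; _++_; map; foldr; length; allFin)
open import Data.List.Relation.Unary.All using (All)
open import Data.List.Relation.Unary.Unique.Propositional using (Unique)
open import Data.List.Membership.Propositional using (_∉_)
open import Data.List.Relation.Binary.Permutation.Propositional using (_↭_)
open import Data.Product using (Σ; _×_; _,_)
open import Relation.Nullary using (¬_; Dec; yes; no; does)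
open import Relation.Binary.PropositionalEquality using (_≡_; refl; cong; cong₂)
open import Relation.Binary.Definitions using (DecidableEquality)
open import Relation.Binary.Core using (Rel)
open import Relation.Binary.Structures using (IsTotalOrder)
open import Algebra.Core using (Op₁; Op₂)
open import Algebra.Structures using (IsCommutativeRing)

-- Coefficient field: an arbitrary ordered field (ℝ is an instance).

record OrderedField (c ℓ : Level) : Set (lsuc (c ⊔ ℓ)) where
  infix  4 _≈_ _≤_
  infixl 6 _+_
  infixl 7 _*_
  field
    Carrier : Set c
    _≈_     : Rel Carrier ℓ
    _+_ _*_ : Op₂ Carrier
    -_      : Op₁ Carrier
    0# 1#   : Carrier
    isCommutativeRing : IsCommutativeRing _≈_ _+_ _*_ -_ 0# 1#
    _≤_     : Rel Carrier ℓ
    isTotalOrder : IsTotalOrder _≈_ _≤_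
    +-monoˡ-≤ : ∀ {a b} c → a ≤ b → a + c ≤ b + c
    *-nonneg  : ∀ {a b} → 0# ≤ a → 0# ≤ b → 0# ≤ a * b
    0≉1       : ¬ (0# ≈ 1#)
    inverse   : ∀ a → ¬ (a ≈ 0#) → Σ Carrier (λ b → a * b ≈ 1#)

-- Rooted binary trees with leaves labelled in A (children ordered in
-- the syntax; unorderedness handled by _≅_ / canonical forms below).

data Tree (A : Set) : Set where
  leaf : A → Tree A
  node : Tree A → Tree A → Tree A

leaves : ∀ {A} → Tree A → List A
leaves (leaf a)   = a ∷ []
leaves (node l r) = leaves l ++ leaves r

mapT : ∀ {A B : Set} → (A → B) → Tree A → Tree B
mapT f (leaf a)   = leaf (f a)
mapT f (node l r) = node (mapT f l) (mapT f r)

data _≅_ {A : Set} : Tree A → Tree A → Set where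
  ≅-refl  : ∀ {t} → t ≅ t
  ≅-sym   : ∀ {s t} → s ≅ t → t ≅ s
  ≅-trans : ∀ {s t u} → s ≅ t → t ≅ u → s ≅ u
  ≅-swap  : ∀ {l r} → node l r ≅ node r l
  ≅-node  : ∀ {l l′ r r′} → l ≅ l′ → r ≅ r′ → node l r ≅ node l′ r′

-- Labelled trees: canonical representatives of label-preserving
-- isomorphism classes (at each node the child containing the smaller
-- minimal label comes first).

minL : ∀ {k} → Tree (Fin k) → Fin k
minL (leaf a)   = a
minL (node l r) = if does (minL l Fin.≤? minL r) then minL l else minL r

order : ∀ {k} → Tree (Fin k) → Tree (Fin k) → Tree (Fin k)
order l r = if does (minL l Fin.≤? minL r) then node l r else node r l

canon : ∀ {k} → Tree (Fin k) → Tree (Fin k)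
canon (leaf a)   = leaf a
canon (node l r) = order (canon l) (canon r)

-- t is (the canonical representative of) an element of RB_L(k):
-- every label in [k] occurs exactly once as a leaf.
RBL : (k : ℕ) → Tree (Fin k) → Set
RBL k t = (canon t ≡ t) × (leaves t ↭ allFin k)

-- t is an element of RB_U(k) (an unlabelled tree, up to ≅)
RBU : (k : ℕ) → Tree ⊤ → Set
RBU k U = length (leaves U) ≡ k

shape : ∀ {A} → Tree A → Tree ⊤
shape = mapT (λ _ → tt)

relabel : ∀ {k} → Permutation′ k → Tree (Fin k) → Tree (Fin k)
relabel σ t = canon (mapT (σ ⟨$⟩ʳ_) t)

-- restriction Q|_{[n]} : keep leaves with label < n, suppress unary vertices
lowLabel : ∀ {m} (n : ℕ) → Fin m → Maybe (Fin n)
lowLabel n a with toℕ a <? n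
... | yes p = just (fromℕ< p)
... | no  _ = nothing

restrict′ : ∀ {m} (n : ℕ) → Tree (Fin m) → Maybe (Tree (Fin n))
restrict′ n (leaf a) with lowLabel n a
... | just b  = just (leaf b)
... | nothing = nothing
restrict′ n (node l r) with restrict′ n l | restrict′ n r
... | just l′  | just r′  = just (node l′ r′)
... | just l′  | nothing  = just l′
... | nothing  | just r′  = just r′
... | nothing  | nothing  = nothing

restrict : ∀ {m} (n : ℕ) → Tree (Fin m) → Maybe (Tree (Fin n))
restrict n t with restrict′ n t
... | just s  = just (canon s)
... | nothing = nothing

_≟T_ : ∀ {A : Set} → DecidableEquality A → DecidableEquality (Tree A)
_≟T_ _≟_ (leaf a) (leaf b) with a ≟ b
... | yes refl = yes refl
... | no ¬p = no λ { refl → ¬p refl }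
_≟T_ _≟_ (leaf a) (node _ _) = no λ ()
_≟T_ _≟_ (node _ _) (leaf b) = no λ ()
_≟T_ _≟_ (node l r) (node l′ r′) with _≟T_ _≟_ l l′ | _≟T_ _≟_ r r′
... | yes refl | yes refl = yes refl
... | no ¬p | _ = no λ { refl → ¬p refl }
... | yes _ | no ¬q = no λ { refl → ¬q refl }

module WithField {c ℓ} (F : OrderedField c ℓ) where
  open OrderedField F

  sumL : List Carrier → Carrier
  sumL = foldr _+_ 0#

  -- a probability distribution on RB_L(k) (extended by 0 to all trees);
  -- supp is a duplicate-free list of elements of RB_L(k) outside of
  -- which the distribution vanishes.
  record Dist (k : ℕ) : Set (c ⊔ ℓ) where
    field
      prob        : Tree (Fin k) → Carrier
      supp        : List (Tree (Fin k))
      supp-unique : Unique supp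
      supp-valid  : All (RBL k) supp
      nonneg      : ∀ t → 0# ≤ prob t
      vanish      : ∀ t → t ∉ supp → prob t ≈ 0#
      total       : sumL (map prob supp) ≈ 1#
  open Dist public

  Exchangeable : ∀ {k} → Dist k → Set ℓ
  Exchangeable {k} p =
    ∀ (σ : Permutation′ k) t → RBL k t → prob p (relabel σ t) ≈ prob p t

  π : ∀ {m} (n : ℕ) → Dist m → Tree (Fin n) → Carrier
  π {m} n p T =
    sumL (map (λ S → if does (≡-decMaybe (_≟T_ Fin._≟_) (restrict n S) (just T))
                     then prob p S else 0#)
              (supp p))

  InO : ∀ {k} → Tree ⊤ → Tree (Fin k) → Set
  InO {k} U t = RBL k t × (shape t ≅ U)

  IsUniformOn : ∀ {k} → Tree ⊤ → Dist k → Set ℓ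
  IsUniformOn {k} U p =
    (∀ x y → InO U x → InO U y → prob p x ≈ prob p y) ×
    (∀ x → RBL k x → ¬ (shape x ≅ U) → prob p x ≈ 0#)

  -- vectors in ℝ^{RB_L(n)} are functions on trees, compared on RB_L(n)
  Vect : ℕ → Set c
  Vect n = Tree (Fin n) → Carrier

  _≐_ : ∀ {n} → Vect n → Vect n → Set ℓ
  _≐_ {n} q s = ∀ T → RBL n T → q T ≈ s T

  EX : (m n : ℕ) → Vect n → Set (c ⊔ ℓ)
  EX m n q = Σ (Dist m) λ p → Exchangeable p × (q ≐ π n p)

  ShapeProj : (m n : ℕ) → Vect n → Set (c ⊔ ℓ)
  ShapeProj m n s =
    Σ (Tree ⊤) λ U → RBU m U × Σ (Dist m) λ p → IsUniformOn U p × (s ≐ π n p)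

  Conv : ∀ {n} → (Vect n → Set (c ⊔ ℓ)) → Vect n → Set (c ⊔ ℓ)
  Conv {n} S q =
    Σ (List (Carrier × Vect n)) λ cs →
      All (λ { (a , s) → (0# ≤ a) × S s }) cs ×
      (sumL (map (λ { (a , _) → a }) cs) ≈ 1#) ×
      (q ≐ λ T → sumL (map (λ { (a , s) → a * s T }) cs))

-- An exchangeable distribution p on RB_L(m) is constant on each orbit O(U) of the relabelling
-- action, because two labelled trees of isomorphic shapes differ by a relabelling. Averaging over
-- orbits therefore writes p as the mixture ∑ₓ p(x) · p_{shape x} over its support, and since π_n is
-- linear, π_n(p) is the same convex combination of the π_n(p_U). Conversely every p_U is
-- exchangeable, and a mixture of exchangeable distributions is exchangeable, with π_n of the
-- mixture the mixture of the π_n.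

module Submission where

open import Defs
open import Data.Nat using (ℕ; zero; suc; _≤_)
open import Function.Bundles using (_⇔_)

open import Level using (_⊔_)
open import Algebra.Bundles using (CommutativeSemiring; CommutativeRing)
import Algebra.Properties.Ring as RingProperties
open import Data.Bool using (Bool; true; false; if_then_else_)
open import Data.Empty using (⊥-elim)
open import Data.Fin using (Fin; zero; suc)
import Data.Fin as Fin
import Data.Fin.Properties as Finₚ
open import Data.Fin.Permutation
  using (Permutation; Permutation′; permutation; flip; cast-id; _∘ₚ_; _⟨$⟩ʳ_; _⟨$⟩ˡ_; inverseˡ; inverseʳ)
open import Data.List
  using (List; []; _∷_; _++_; map; foldr; length; allFin; lookup; filter; deduplicate; concatMap; cartesianProductWith)
open import Data.List.Properties using (map-++; map-∘; length-map; ∷-injective; ∷-injectiveˡ; length-tabulate)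
open import Data.List.Relation.Unary.Any as Any using (here; there)
open import Data.List.Relation.Unary.Any.Properties using (lookup-index)
open import Data.List.Relation.Unary.All as All using (All; []; _∷_)
import Data.List.Relation.Unary.All.Properties as Allₚ
open import Data.List.Relation.Unary.Unique.Propositional using (Unique; []; _∷_)
import Data.List.Relation.Unary.Unique.Propositional.Properties as Uniqueₚ
open import Data.List.Relation.Unary.Unique.DecPropositional using (unique?)
open import Data.List.Relation.Unary.Unique.DecPropositional.Properties using (deduplicate-!)
open import Data.List.Membership.Propositional using (_∈_; _∉_; lose; find)
open import Data.List.Membership.Propositional.Properties
  using (∈-++⁺ˡ; ∈-++⁺ʳ; ∈-map⁺; ∈-map⁻; ∈-allFin; ∈-lookup; ∈-filter⁺; ∈-filter⁻; ∈-deduplicate⁺; ∈-deduplicate⁻;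
         ∈-concatMap⁺; ∈-concatMap⁻; ∈-cartesianProductWith⁺; ∈-cartesianProductWith⁻)
open import Data.List.Membership.Propositional.Properties.WithK using (unique∧set⇒bag; unique⇒irrelevant)
open import Data.List.Relation.Binary.Subset.Propositional using (_⊆_)
open import Data.List.Relation.Binary.Disjoint.Propositional using (Disjoint)
open import Data.List.Relation.Binary.BagAndSetEquality using (∼bag⇒↭)
open import Data.List.Relation.Binary.Permutation.Propositional
  using (_↭_; ↭-refl; ↭-sym; ↭-trans; ↭⇒↭ₛ; ↭⇒↭ₛ′)
open import Data.List.Relation.Binary.Permutation.Propositional.Properties as Permₚ
  using (∈-resp-↭; ++⁺; ++-comm; ↭-length)
import Data.List.Relation.Binary.Permutation.Setoid.Properties as Permₛ
open import Data.Maybe using (just)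
open import Data.Maybe.Properties using () renaming (≡-dec to ≡-decMaybe)
open import Data.Nat.Properties using (suc-injective; <⇒≤; <⇒≱)
open import Data.Product using (Σ; _×_; _,_; proj₁; proj₂)
open import Data.Sum using (inj₁; inj₂)
open import Data.Unit using (⊤)
open import Function.Base using (_∘_)
open import Function.Bundles using (mk⇔)
open import Relation.Binary.Definitions using (DecidableEquality; tri<; tri≈; tri>)
open import Relation.Binary.Structures using (IsTotalOrder)
open import Relation.Binary.PropositionalEquality as ≡
  using (_≡_; _≢_; refl; sym; trans; cong; cong₂; subst; module ≡-Reasoning)
open import Relation.Nullary using (¬_; yes; no; does)
open import Relation.Nullary.Decidable using (_×-dec_; dec-true; dec-false)
open import Relation.Unary using (Pred; Decidable)

Unique-resp-↭ : ∀ {A : Set} {xs ys : List A} → xs ↭ ys → Unique xs → Unique ys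
Unique-resp-↭ ρ = Permₛ.Unique-resp-↭ (≡.setoid _) (↭⇒↭ₛ ρ)

Unique-++⁻ : ∀ {A : Set} (xs : List A) {ys} →
             Unique (xs ++ ys) → Unique xs × Unique ys × Disjoint xs ys
Unique-++⁻ []       u        = [] , u , λ ()
Unique-++⁻ (x ∷ xs) (x∉ ∷ u) with uxs , uys , disjoint ← Unique-++⁻ xs u =
  Allₚ.++⁻ˡ xs x∉ ∷ uxs , uys , λ where
    (here refl  , y∈ys) → All.lookup x∉ (∈-++⁺ʳ xs y∈ys) refl
    (there y∈xs , y∈ys) → disjoint (y∈xs , y∈ys)

unique∧set⇒↭ : ∀ {A : Set} {xs ys : List A} → Unique xs → Unique ys → xs ⊆ ys → ys ⊆ xs → xs ↭ ys
unique∧set⇒↭ uxs uys xs⊆ys ys⊆xs = ∼bag⇒↭ (unique∧set⇒bag uxs uys (mk⇔ xs⊆ys ys⊆xs))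

++-cancel-length : ∀ {A : Set} (xs ys : List A) {zs ws} → length xs ≡ length ys →
                   xs ++ zs ≡ ys ++ ws → xs ≡ ys × zs ≡ ws
++-cancel-length []       []       _   eq = refl , eq
++-cancel-length (x ∷ xs) (y ∷ ys) len eq
  with refl , eq′   ← ∷-injective eq
  with refl , zs≡ws ← ++-cancel-length xs ys (suc-injective len) eq′
  = refl , zs≡ws

map-via-lookup : ∀ {A B : Set} (f : A → B) (xs : List A) (ys : List B) (len : length xs ≡ length ys) →
                 (∀ i → f (lookup xs i) ≡ lookup ys (Fin.cast len i)) → map f xs ≡ ys
map-via-lookup f []       []       _   _  = refl
map-via-lookup f (x ∷ xs) (y ∷ ys) len eq =
  cong₂ _∷_ (eq zero) (map-via-lookup f xs ys (suc-injective len) (eq ∘ suc))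

index-∈-lookup : ∀ {A : Set} (xs : List A) i → Any.index (∈-lookup {xs = xs} i) ≡ i
index-∈-lookup (x ∷ xs) zero    = refl
index-∈-lookup (x ∷ xs) (suc i) = cong suc (index-∈-lookup xs i)

module _ {m : ℕ} {xs : List (Fin m)} where

  ↭-allFin⇒Unique : xs ↭ allFin m → Unique xs
  ↭-allFin⇒Unique ρ = Unique-resp-↭ (↭-sym ρ) (Uniqueₚ.allFin⁺ m)

  ↭-allFin⇒∈ : xs ↭ allFin m → ∀ a → a ∈ xs
  ↭-allFin⇒∈ ρ a = ∈-resp-↭ (↭-sym ρ) (∈-allFin a)

  ↭-allFin⇒length : xs ↭ allFin m → length xs ≡ m
  ↭-allFin⇒length ρ = trans (↭-length ρ) (length-tabulate {n = m} (λ i → i))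

  Unique∧∈⇒↭-allFin : Unique xs → (∀ a → a ∈ xs) → xs ↭ allFin m
  Unique∧∈⇒↭-allFin u complete =
    unique∧set⇒↭ u (Uniqueₚ.allFin⁺ m) (λ _ → ∈-allFin _) (λ {a} _ → complete a)

enumeration : ∀ {m} (xs : List (Fin m)) → Unique xs → (∀ a → a ∈ xs) → Permutation (length xs) m
enumeration xs u complete = permutation (lookup xs) (Any.index ∘ complete)
  (λ a → sym (lookup-index (complete a)))
  (λ i → trans (cong Any.index (unique⇒irrelevant u (complete (lookup xs i)) (∈-lookup i)))
               (index-∈-lookup xs i))

↭-allFin⇒relabelling : ∀ {m} {xs ys : List (Fin m)} → xs ↭ allFin m → ys ↭ allFin m →
                        Σ (Permutation′ m) λ σ → map (σ ⟨$⟩ʳ_) xs ≡ ys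
↭-allFin⇒relabelling {m} {xs} {ys} ρx ρy =
  σ , map-via-lookup (σ ⟨$⟩ʳ_) xs ys len (λ i → cong (lookup ys ∘ Fin.cast len) (inverseˡ enum-xs))
  where
  enum-xs = enumeration xs (↭-allFin⇒Unique ρx) (↭-allFin⇒∈ ρx)
  enum-ys = enumeration ys (↭-allFin⇒Unique ρy) (↭-allFin⇒∈ ρy)
  len = trans (↭-allFin⇒length ρx) (sym (↭-allFin⇒length ρy))
  σ : Permutation′ m
  σ = flip enum-xs ∘ₚ cast-id len ∘ₚ enum-ys

leaves-mapT : ∀ {A B : Set} (f : A → B) t → leaves (mapT f t) ≡ map f (leaves t)
leaves-mapT f (leaf a)   = refl
leaves-mapT f (node l r) =
  trans (cong₂ _++_ (leaves-mapT f l) (leaves-mapT f r)) (sym (map-++ f (leaves l) (leaves r)))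

shape-mapT : ∀ {A B : Set} (f : A → B) t → shape (mapT f t) ≡ shape t
shape-mapT f (leaf a)   = refl
shape-mapT f (node l r) = cong₂ node (shape-mapT f l) (shape-mapT f r)

length-leaves-shape : ∀ {A : Set} (t : Tree A) → length (leaves (shape t)) ≡ length (leaves t)
length-leaves-shape t = trans (cong length (leaves-mapT _ t)) (length-map _ (leaves t))

shape≡⇒length-leaves≡ : ∀ {A : Set} {s t : Tree A} → shape s ≡ shape t → length (leaves s) ≡ length (leaves t)
shape≡⇒length-leaves≡ {s = s} {t} eq =
  trans (sym (length-leaves-shape s)) (trans (cong (length ∘ leaves) eq) (length-leaves-shape t))

node-injective : ∀ {A : Set} {l l′ r r′ : Tree A} → node l r ≡ node l′ r′ → l ≡ l′ × r ≡ r′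
node-injective refl = refl , refl

shape∧leaves⇒≡ : ∀ {A : Set} {s t : Tree A} → shape s ≡ shape t → leaves s ≡ leaves t → s ≡ t
shape∧leaves⇒≡ {s = leaf a}   {leaf b}     _  eq = cong leaf (∷-injectiveˡ eq)
shape∧leaves⇒≡ {s = node l r} {node l′ r′} sh eq
  with shl , shr ← node-injective sh
  with eql , eqr ← ++-cancel-length (leaves l) (leaves l′) (shape≡⇒length-leaves≡ shl) eq
  = cong₂ node (shape∧leaves⇒≡ shl eql) (shape∧leaves⇒≡ shr eqr)

≅-leaves : ∀ {A : Set} {s t : Tree A} → s ≅ t → leaves s ↭ leaves t
≅-leaves ≅-refl           = ↭-refl
≅-leaves (≅-sym d)        = ↭-sym (≅-leaves d)
≅-leaves (≅-trans d e)    = ↭-trans (≅-leaves d) (≅-leaves e)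
≅-leaves (≅-swap {l} {r}) = ++-comm (leaves l) (leaves r)
≅-leaves (≅-node d e)     = ++⁺ (≅-leaves d) (≅-leaves e)

≅-mapT : ∀ {A B : Set} (f : A → B) {s t : Tree A} → s ≅ t → mapT f s ≅ mapT f t
≅-mapT f ≅-refl        = ≅-refl
≅-mapT f (≅-sym d)     = ≅-sym (≅-mapT f d)
≅-mapT f (≅-trans d e) = ≅-trans (≅-mapT f d) (≅-mapT f e)
≅-mapT f ≅-swap        = ≅-swap
≅-mapT f (≅-node d e)  = ≅-node (≅-mapT f d) (≅-mapT f e)

mutual
  reshape⁺ : ∀ {A : Set} {u v : Tree ⊤} → u ≅ v → (s : Tree A) → shape s ≡ u →
             Σ (Tree A) λ t → shape t ≡ v × s ≅ t
  reshape⁺ ≅-refl        s eq = s , eq , ≅-refl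
  reshape⁺ (≅-sym d)     s eq = reshape⁻ d s eq
  reshape⁺ (≅-trans d e) s eq
    with t  , eq′ , s≅t  ← reshape⁺ d s eq
    with t′ , eq″ , t≅t′ ← reshape⁺ e t eq′
    = t′ , eq″ , ≅-trans s≅t t≅t′
  reshape⁺ ≅-swap        (node a b) refl = node b a , refl , ≅-swap
  reshape⁺ (≅-node d e)  (node a b) refl
    with a′ , refl , a≅a′ ← reshape⁺ d a refl
    with b′ , refl , b≅b′ ← reshape⁺ e b refl
    = node a′ b′ , refl , ≅-node a≅a′ b≅b′

  reshape⁻ : ∀ {A : Set} {u v : Tree ⊤} → u ≅ v → (s : Tree A) → shape s ≡ v →
             Σ (Tree A) λ t → shape t ≡ u × s ≅ t
  reshape⁻ ≅-refl        s eq = s , eq , ≅-refl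
  reshape⁻ (≅-sym d)     s eq = reshape⁺ d s eq
  reshape⁻ (≅-trans d e) s eq
    with t  , eq′ , s≅t  ← reshape⁻ e s eq
    with t′ , eq″ , t≅t′ ← reshape⁻ d t eq′
    = t′ , eq″ , ≅-trans s≅t t≅t′
  reshape⁻ ≅-swap        (node a b) refl = node b a , refl , ≅-swap
  reshape⁻ (≅-node d e)  (node a b) refl
    with a′ , refl , a≅a′ ← reshape⁻ d a refl
    with b′ , refl , b≅b′ ← reshape⁻ e b refl
    = node a′ b′ , refl , ≅-node a≅a′ b≅b′

reshape : ∀ {A : Set} {U : Tree ⊤} (s : Tree A) → shape s ≅ U → Σ (Tree A) λ t → shape t ≡ U × s ≅ t
reshape s d = reshape⁺ d s refl

order-≅ : ∀ {k} (l r : Tree (Fin k)) → order l r ≅ node l r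
order-≅ l r with does (minL l Fin.≤? minL r)
... | true  = ≅-refl
... | false = ≅-swap

canon-≅ : ∀ {k} (t : Tree (Fin k)) → canon t ≅ t
canon-≅ (leaf a)   = ≅-refl
canon-≅ (node l r) = ≅-trans (order-≅ (canon l) (canon r)) (≅-node (canon-≅ l) (canon-≅ r))

minL-∈ : ∀ {k} (t : Tree (Fin k)) → minL t ∈ leaves t
minL-∈ (leaf a)   = here refl
minL-∈ (node l r) with does (minL l Fin.≤? minL r)
... | true  = ∈-++⁺ˡ (minL-∈ l)
... | false = ∈-++⁺ʳ (leaves l) (minL-∈ r)

order-≤ : ∀ {k} (l r : Tree (Fin k)) → minL l Fin.≤ minL r → order l r ≡ node l r
order-≤ l r p = cong (if_then node l r else node r l) (dec-true (minL l Fin.≤? minL r) p)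

order-≰ : ∀ {k} (l r : Tree (Fin k)) → ¬ minL l Fin.≤ minL r → order l r ≡ node r l
order-≰ l r p = cong (if_then node l r else node r l) (dec-false (minL l Fin.≤? minL r) p)

order-comm : ∀ {k} (l r : Tree (Fin k)) → minL l ≢ minL r → order l r ≡ order r l
order-comm l r l≢r with Finₚ.<-cmp (minL l) (minL r)
... | tri< l<r _ _ = trans (order-≤ l r (<⇒≤ l<r)) (sym (order-≰ r l (<⇒≱ l<r)))
... | tri≈ _ l≡r _ = ⊥-elim (l≢r l≡r)
... | tri> _ _ r<l = trans (order-≰ l r (<⇒≱ r<l)) (sym (order-≤ r l (<⇒≤ r<l)))

canon-cong : ∀ {k} {s t : Tree (Fin k)} → s ≅ t → Unique (leaves s) → canon s ≡ canon t
canon-cong ≅-refl           _ = refl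
canon-cong (≅-sym d)        u = sym (canon-cong d (Unique-resp-↭ (≅-leaves (≅-sym d)) u))
canon-cong (≅-trans d e)    u = trans (canon-cong d u) (canon-cong e (Unique-resp-↭ (≅-leaves d) u))
canon-cong (≅-swap {l} {r}) u with _ , _ , disjoint ← Unique-++⁻ (leaves l) u =
  order-comm (canon l) (canon r) λ eq →
    disjoint (∈-resp-↭ (≅-leaves (canon-≅ l)) (minL-∈ (canon l)) ,
              ∈-resp-↭ (≅-leaves (canon-≅ r)) (subst (_∈ leaves (canon r)) (sym eq) (minL-∈ (canon r))))
canon-cong (≅-node {l} d e) u with ul , ur , _ ← Unique-++⁻ (leaves l) u =
  cong₂ order (canon-cong d ul) (canon-cong e ur)

canon-idem : ∀ {k} (t : Tree (Fin k)) → Unique (leaves t) → canon (canon t) ≡ canon t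
canon-idem t u = canon-cong (canon-≅ t) (Unique-resp-↭ (↭-sym (≅-leaves (canon-≅ t))) u)

module _ {m : ℕ} (σ : Permutation′ m) where

  relabel-RBL : ∀ {t} → RBL m t → RBL m (relabel σ t)
  relabel-RBL {t} (_ , ρ) =
    canon-idem s unique-s , ↭-trans (≅-leaves (canon-≅ s)) (Unique∧∈⇒↭-allFin unique-s complete-s)
    where
    s = mapT (σ ⟨$⟩ʳ_) t
    σ-injective : ∀ {a b} → σ ⟨$⟩ʳ a ≡ σ ⟨$⟩ʳ b → a ≡ b
    σ-injective eq = trans (sym (inverseˡ σ)) (trans (cong (σ ⟨$⟩ˡ_) eq) (inverseˡ σ))
    unique-s : Unique (leaves s)
    unique-s = subst Unique (sym (leaves-mapT _ t)) (Uniqueₚ.map⁺ σ-injective (↭-allFin⇒Unique ρ))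
    complete-s : ∀ a → a ∈ leaves s
    complete-s a = subst (a ∈_) (sym (leaves-mapT _ t))
      (subst (_∈ map (σ ⟨$⟩ʳ_) (leaves t)) (inverseʳ σ) (∈-map⁺ (σ ⟨$⟩ʳ_) (↭-allFin⇒∈ ρ (σ ⟨$⟩ˡ a))))

  shape-relabel : ∀ t → shape (relabel σ t) ≅ shape t
  shape-relabel t = subst (shape (relabel σ t) ≅_) (shape-mapT _ t) (≅-mapT _ (canon-≅ _))

same-shape⇒relabel : ∀ {m x y} → RBL m x → RBL m y → shape x ≅ shape y →
                     Σ (Permutation′ m) λ σ → relabel σ x ≡ y
same-shape⇒relabel {m} {x} {y} (_ , ρx) (canon-y , ρy) d
  with t , shape-t , y≅t ← reshape y (≅-sym d)
  with σ , σx≡t ← ↭-allFin⇒relabelling ρx (↭-trans (↭-sym (≅-leaves y≅t)) ρy)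
  = σ , (begin
    canon (mapT (σ ⟨$⟩ʳ_) x) ≡⟨ cong canon (shape∧leaves⇒≡ (trans (shape-mapT _ x) (sym shape-t))
                                                          (trans (leaves-mapT _ x) σx≡t)) ⟩
    canon t                  ≡⟨ canon-cong (≅-sym y≅t) (Unique-resp-↭ (≅-leaves y≅t) (↭-allFin⇒Unique ρy)) ⟩
    canon y                  ≡⟨ canon-y ⟩
    y                        ∎)
  where open ≡-Reasoning

module _ (m : ℕ) where

  labellings : Tree ⊤ → List (Tree (Fin m))
  labellings (leaf _)   = map leaf (allFin m)
  labellings (node U V) = cartesianProductWith node (labellings U) (labellings V)

  ∈-labellings : ∀ t → t ∈ labellings (shape t)
  ∈-labellings (leaf a)   = ∈-map⁺ leaf (∈-allFin a)
  ∈-labellings (node l r) = ∈-cartesianProductWith⁺ node (∈-labellings l) (∈-labellings r)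

  labellings-shape : ∀ U {t} → t ∈ labellings U → shape t ≡ U
  labellings-shape (leaf _)   t∈ with _ , _ , refl ← ∈-map⁻ leaf t∈ = refl
  labellings-shape (node U V) t∈
    with _ , _ , l∈ , r∈ , refl ← ∈-cartesianProductWith⁻ node (labellings U) (labellings V) t∈
    = cong₂ node (labellings-shape U l∈) (labellings-shape V r∈)

  Bijective : Tree (Fin m) → Set
  Bijective t = Unique (leaves t) × (∀ a → a ∈ leaves t)

  bijective? : Decidable Bijective
  bijective? t = unique? Fin._≟_ (leaves t) ×-dec Finₚ.all? (_∈? leaves t)
    where open import Data.List.Membership.DecPropositional Fin._≟_ using (_∈?_)

  _≟ᵀ_ : DecidableEquality (Tree (Fin m))
  _≟ᵀ_ = _≟T_ Fin._≟_

  orbit : Tree ⊤ → List (Tree (Fin m))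
  orbit U = deduplicate _≟ᵀ_ (map canon (filter bijective? (labellings U)))

  orbit-unique : ∀ U → Unique (orbit U)
  orbit-unique U = deduplicate-! _≟ᵀ_ _

  orbit-sound : ∀ U {y} → y ∈ orbit U → RBL m y × shape y ≅ U
  orbit-sound U y∈
    with t , t∈ , refl ← ∈-map⁻ canon (∈-deduplicate⁻ _≟ᵀ_ _ y∈)
    with t∈U , unique-t , complete-t ← ∈-filter⁻ bijective? t∈
    = (canon-idem t unique-t , ↭-trans (≅-leaves (canon-≅ t)) (Unique∧∈⇒↭-allFin unique-t complete-t)) ,
      subst (shape (canon t) ≅_) (labellings-shape U t∈U) (≅-mapT _ (canon-≅ t))

  orbit-complete : ∀ U {y} → RBL m y → shape y ≅ U → y ∈ orbit U
  orbit-complete U {y} (canon-y , ρy) d with t , refl , y≅t ← reshape y d =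
    ∈-deduplicate⁺ _≟ᵀ_ (subst (_∈ map canon (filter bijective? (labellings (shape t)))) canon-t≡y
      (∈-map⁺ canon (∈-filter⁺ bijective? (∈-labellings t) (↭-allFin⇒Unique ρt , ↭-allFin⇒∈ ρt))))
    where
    ρt = ↭-trans (↭-sym (≅-leaves y≅t)) ρy
    canon-t≡y = trans (sym (canon-cong y≅t (↭-allFin⇒Unique ρy))) canon-y

  orbit-≅ : ∀ {U V} → U ≅ V → orbit U ↭ orbit V
  orbit-≅ {U} {V} d = unique∧set⇒↭ (orbit-unique U) (orbit-unique V)
    (λ y∈ → let ry , dy = orbit-sound U y∈ in orbit-complete V ry (≅-trans dy d))
    (λ y∈ → let ry , dy = orbit-sound V y∈ in orbit-complete U ry (≅-trans dy (≅-sym d)))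

module ListSum {c ℓ} (R : CommutativeSemiring c ℓ) where

  open CommutativeSemiring R hiding (zero) renaming (refl to ≈-refl; sym to ≈-sym; trans to ≈-trans)
  open import Relation.Binary.Reasoning.Setoid setoid

  ∑ : ∀ {a} {A : Set a} → List A → (A → Carrier) → Carrier
  ∑ xs f = foldr _+_ 0# (map f xs)

  mask : Bool → Carrier → Carrier
  mask b x = if b then x else 0#

  fromℕ : ℕ → Carrier
  fromℕ zero    = 0#
  fromℕ (suc k) = 1# + fromℕ k

  module _ {a} {A : Set a} where

    ∑-cong : ∀ (xs : List A) {f g : A → Carrier} → (∀ x → x ∈ xs → f x ≈ g x) → ∑ xs f ≈ ∑ xs g
    ∑-cong []       _  = ≈-refl
    ∑-cong (x ∷ xs) eq = +-cong (eq x (here refl)) (∑-cong xs λ y y∈ → eq y (there y∈))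

    ∑-zero : ∀ (xs : List A) {f : A → Carrier} → (∀ x → x ∈ xs → f x ≈ 0#) → ∑ xs f ≈ 0#
    ∑-zero []       _  = ≈-refl
    ∑-zero (x ∷ xs) eq =
      ≈-trans (+-cong (eq x (here refl)) (∑-zero xs λ y y∈ → eq y (there y∈))) (+-identityˡ 0#)

    ∑-const : ∀ (xs : List A) a → ∑ xs (λ _ → a) ≈ fromℕ (length xs) * a
    ∑-const []       a = ≈-sym (zeroˡ a)
    ∑-const (_ ∷ xs) a = ≈-trans (+-cong (≈-sym (*-identityˡ a)) (∑-const xs a)) (≈-sym (distribʳ a 1# _))

    ∑-*ˡ : ∀ (xs : List A) a (f : A → Carrier) → a * ∑ xs f ≈ ∑ xs (λ x → a * f x)
    ∑-*ˡ []       a f = zeroʳ a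
    ∑-*ˡ (x ∷ xs) a f = ≈-trans (distribˡ a (f x) (∑ xs f)) (+-congˡ (∑-*ˡ xs a f))

    ∑-+ : ∀ (xs : List A) (f g : A → Carrier) → ∑ xs (λ x → f x + g x) ≈ ∑ xs f + ∑ xs g
    ∑-+ []       f g = ≈-sym (+-identityˡ 0#)
    ∑-+ (x ∷ xs) f g = begin
      (f x + g x) + ∑ xs (λ x → f x + g x) ≈⟨ +-congˡ (∑-+ xs f g) ⟩
      (f x + g x) + (∑ xs f + ∑ xs g)      ≈⟨ +-assoc (f x) (g x) _ ⟩
      f x + (g x + (∑ xs f + ∑ xs g))      ≈⟨ +-congˡ (≈-sym (+-assoc (g x) _ _)) ⟩
      f x + ((g x + ∑ xs f) + ∑ xs g)      ≈⟨ +-congˡ (+-congʳ (+-comm (g x) _)) ⟩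
      f x + ((∑ xs f + g x) + ∑ xs g)      ≈⟨ +-congˡ (+-assoc _ (g x) _) ⟩
      f x + (∑ xs f + (g x + ∑ xs g))      ≈⟨ ≈-sym (+-assoc (f x) _ _) ⟩
      (f x + ∑ xs f) + (g x + ∑ xs g)      ∎

    ∑-↭ : ∀ {xs ys : List A} (f : A → Carrier) → xs ↭ ys → ∑ xs f ≈ ∑ ys f
    ∑-↭ f ρ = Permₛ.foldr-commMonoid setoid +-isCommutativeMonoid (↭⇒↭ₛ′ isEquivalence (Permₚ.map⁺ f ρ))

    mask-∑ : ∀ b (xs : List A) (f : A → Carrier) → mask b (∑ xs f) ≈ ∑ xs (λ x → mask b (f x))
    mask-∑ true  xs f = ≈-refl
    mask-∑ false xs f = ≈-sym (∑-zero xs λ _ _ → ≈-refl)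

  ∑-swap : ∀ {a b} {A : Set a} {B : Set b} (xs : List A) (ys : List B) (f : A → B → Carrier) →
           ∑ xs (λ x → ∑ ys (f x)) ≈ ∑ ys (λ y → ∑ xs (λ x → f x y))
  ∑-swap []       ys f = ≈-sym (∑-zero ys λ _ _ → ≈-refl)
  ∑-swap (x ∷ xs) ys f = ≈-trans (+-congˡ (∑-swap xs ys f)) (≈-sym (∑-+ ys (f x) _))

  ∑-toList : ∀ {a p} {A : Set a} {P : Pred A p} {xs : List A} (ps : All P xs) (f : A → Carrier) →
             ∑ (All.toList ps) (f ∘ proj₁) ≡ ∑ xs f
  ∑-toList []       f = refl
  ∑-toList (_ ∷ ps) f = cong (f _ +_) (∑-toList ps f)

  mask-cong : ∀ b {x y} → x ≈ y → mask b x ≈ mask b y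
  mask-cong true  eq = eq
  mask-cong false _  = ≈-refl

  mask-zero : ∀ b {x} → x ≈ 0# → mask b x ≈ 0#
  mask-zero true  eq = eq
  mask-zero false _  = ≈-refl

  mask-*ˡ : ∀ b x y → mask b (x * y) ≈ x * mask b y
  mask-*ˡ true  x y = ≈-refl
  mask-*ˡ false x y = ≈-sym (zeroʳ x)

  mask-*-comm : ∀ b x y → x * mask b y ≈ y * mask b x
  mask-*-comm true  x y = *-comm x y
  mask-*-comm false x y = ≈-trans (zeroʳ x) (≈-sym (zeroʳ y))

  module _ {A : Set} where

    ∑-filter : ∀ {p} {P : Pred A p} (P? : Decidable P) (xs : List A) (f : A → Carrier) →
               (∀ x → x ∈ xs → ¬ P x → f x ≈ 0#) → ∑ xs f ≈ ∑ (filter P? xs) f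
    ∑-filter P? []       f _      = ≈-refl
    ∑-filter P? (x ∷ xs) f vanish with P? x
    ... | yes _  = +-congˡ (∑-filter P? xs f λ y y∈ → vanish y (there y∈))
    ... | no ¬px = ≈-trans (+-cong (vanish x (here refl) ¬px) (∑-filter P? xs f λ y y∈ → vanish y (there y∈)))
                           (+-identityˡ _)

    ∑-reindex : DecidableEquality A → ∀ {xs ys : List A} (f : A → Carrier) → Unique xs → Unique ys →
                (∀ x → x ∉ xs → f x ≈ 0#) → (∀ x → x ∉ ys → f x ≈ 0#) → ∑ xs f ≈ ∑ ys f
    ∑-reindex _≟_ {xs} {ys} f uxs uys vanish-xs vanish-ys = begin
      ∑ xs f                   ≈⟨ ∑-filter (_∈? ys) xs f (λ x _ → vanish-ys x) ⟩
      ∑ (filter (_∈? ys) xs) f ≈⟨ ∑-↭ f common-↭ ⟩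
      ∑ (filter (_∈? xs) ys) f ≈⟨ ≈-sym (∑-filter (_∈? xs) ys f (λ x _ → vanish-xs x)) ⟩
      ∑ ys f                   ∎
      where
      open import Data.List.Membership.DecPropositional _≟_ using (_∈?_)
      common-↭ : filter (_∈? ys) xs ↭ filter (_∈? xs) ys
      common-↭ = unique∧set⇒↭ (Uniqueₚ.filter⁺ (_∈? ys) uxs) (Uniqueₚ.filter⁺ (_∈? xs) uys)
        (λ x∈ → let x∈xs , x∈ys = ∈-filter⁻ (_∈? ys) x∈ in ∈-filter⁺ (_∈? xs) x∈ys x∈xs)
        (λ x∈ → let x∈ys , x∈xs = ∈-filter⁻ (_∈? xs) x∈ in ∈-filter⁺ (_∈? ys) x∈xs x∈ys)

module OrderedFieldProperties {c ℓ} (F : OrderedField c ℓ) where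

  open OrderedField F using (isTotalOrder; +-monoˡ-≤; *-nonneg; 0≉1; inverse) renaming (_≤_ to _≤ᶠ_)

  commutativeRing : CommutativeRing c ℓ
  commutativeRing = record { isCommutativeRing = OrderedField.isCommutativeRing F }

  open CommutativeRing commutativeRing public renaming (refl to ≈-refl; sym to ≈-sym; trans to ≈-trans)
  open RingProperties ring using (-‿distribˡ-*; -‿distribʳ-*; -‿involutive)
  module ≤ = IsTotalOrder isTotalOrder
  open ListSum commutativeSemiring public

  ≤-respʳ : ∀ {x y z} → x ≈ y → z ≤ᶠ x → z ≤ᶠ y
  ≤-respʳ = ≤.≲-respʳ-≈

  ≤-respˡ : ∀ {x y z} → x ≈ y → x ≤ᶠ z → y ≤ᶠ z
  ≤-respˡ = ≤.≲-respˡ-≈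

  neg-nonneg : ∀ {a} → a ≤ᶠ 0# → 0# ≤ᶠ - a
  neg-nonneg {a} a≤0 = ≤-respʳ (+-identityˡ (- a)) (≤-respˡ (-‿inverseʳ a) (+-monoˡ-≤ (- a) a≤0))

  nonneg-neg : ∀ {a} → 0# ≤ᶠ - a → a ≤ᶠ 0#
  nonneg-neg {a} 0≤-a = ≤-respʳ (-‿inverseˡ a) (≤-respˡ (+-identityˡ a) (+-monoˡ-≤ a 0≤-a))

  0≤1 : 0# ≤ᶠ 1#
  0≤1 with ≤.total 0# 1#
  ... | inj₁ 0≤1 = 0≤1
  ... | inj₂ 1≤0 = ≤-respʳ -1*-1≈1 (*-nonneg (neg-nonneg 1≤0) (neg-nonneg 1≤0))
    where
    -1*-1≈1 : - 1# * - 1# ≈ 1#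
    -1*-1≈1 = ≈-trans (≈-sym (-‿distribˡ-* 1# (- 1#))) (≈-trans (-‿cong (*-identityˡ (- 1#))) (-‿involutive 1#))

  +-nonneg : ∀ {a b} → 0# ≤ᶠ a → 0# ≤ᶠ b → 0# ≤ᶠ a + b
  +-nonneg {a} {b} 0≤a 0≤b = ≤.trans 0≤b (≤-respˡ (+-identityˡ b) (+-monoˡ-≤ b 0≤a))

  inverse-nonneg : ∀ {a b} → 0# ≤ᶠ a → a * b ≈ 1# → 0# ≤ᶠ b
  inverse-nonneg {a} {b} 0≤a ab≈1 with ≤.total 0# b
  ... | inj₁ 0≤b = 0≤b
  ... | inj₂ b≤0 = ⊥-elim (0≉1 (≤.antisym 0≤1 (nonneg-neg (≤-respʳ a*-b≈-1 (*-nonneg 0≤a (neg-nonneg b≤0))))))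
    where
    a*-b≈-1 : a * - b ≈ - 1#
    a*-b≈-1 = ≈-trans (≈-sym (-‿distribʳ-* a b)) (-‿cong ab≈1)

  fromℕ-nonneg : ∀ k → 0# ≤ᶠ fromℕ k
  fromℕ-nonneg zero    = ≤.refl
  fromℕ-nonneg (suc k) = +-nonneg 0≤1 (fromℕ-nonneg k)

  fromℕ-suc≉0 : ∀ k → ¬ (fromℕ (suc k) ≈ 0#)
  fromℕ-suc≉0 k 1+k≈0 = 0≉1 (≤.antisym 0≤1 (≤-respʳ 1+k≈0 1≤1+k))
    where
    1≤1+k : 1# ≤ᶠ fromℕ (suc k)
    1≤1+k = ≤-respˡ (+-identityʳ 1#) (≤-respʳ (+-comm (fromℕ k) 1#)
              (≤-respˡ (+-comm 0# 1#) (+-monoˡ-≤ 1# (fromℕ-nonneg k))))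

  -- recip k = 1/k, with the junk value recip 0 = 0
  recip : ℕ → Carrier
  recip zero    = 0#
  recip (suc k) = proj₁ (inverse (fromℕ (suc k)) (fromℕ-suc≉0 k))

  recip-inverse : ∀ k → fromℕ (suc k) * recip (suc k) ≈ 1#
  recip-inverse k = proj₂ (inverse (fromℕ (suc k)) (fromℕ-suc≉0 k))

  recip-nonneg : ∀ k → 0# ≤ᶠ recip k
  recip-nonneg zero    = ≤.refl
  recip-nonneg (suc k) = inverse-nonneg (fromℕ-nonneg (suc k)) (recip-inverse k)

  recip-length : ∀ {a} {A : Set a} {xs : List A} {x} → x ∈ xs → fromℕ (length xs) * recip (length xs) ≈ 1#
  recip-length {xs = _ ∷ xs} _ = recip-inverse (length xs)

  ∑-nonneg : ∀ {a} {A : Set a} (xs : List A) {f : A → Carrier} → (∀ x → x ∈ xs → 0# ≤ᶠ f x) → 0# ≤ᶠ ∑ xs f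
  ∑-nonneg []       _      = ≤.refl
  ∑-nonneg (x ∷ xs) nonneg = +-nonneg (nonneg x (here refl)) (∑-nonneg xs λ y y∈ → nonneg y (there y∈))

  mask-nonneg : ∀ b {x} → 0# ≤ᶠ x → 0# ≤ᶠ mask b x
  mask-nonneg true  0≤x = 0≤x
  mask-nonneg false _   = ≤.refl

module Uniform {c ℓ} (F : OrderedField c ℓ) {A : Set} (_≟_ : DecidableEquality A) where

  open OrderedFieldProperties F
  open import Data.List.Membership.DecPropositional _≟_ using (_∈?_)
  open import Relation.Binary.Reasoning.Setoid setoid

  masked : List A → A → Carrier → Carrier
  masked xs y a = mask (does (y ∈? xs)) a

  masked-∈ : ∀ {xs y} a → y ∈ xs → masked xs y a ≡ a
  masked-∈ {xs} {y} a y∈ = cong (λ b → mask b a) (dec-true (y ∈? xs) y∈)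

  masked-∉ : ∀ {xs y} a → y ∉ xs → masked xs y a ≡ 0#
  masked-∉ {xs} {y} a y∉ = cong (λ b → mask b a) (dec-false (y ∈? xs) y∉)

  uniformOn : List A → A → Carrier
  uniformOn xs y = masked xs y (recip (length xs))

  -- Both sides of ∑-orbit-average equal ∑ {x, y ∈ support, y ∈ orbit x} p x · g y / |orbit x|,
  -- summed by rows (x) on the right and by columns (y) on the left.
  module OrbitAverage (orbit : A → List A) (orbit-unique : ∀ x → Unique (orbit x))
                      (orbit-↭ : ∀ {x y} → y ∈ orbit x → orbit x ↭ orbit y)
                      {support : List A} (support-unique : Unique support) {p : A → Carrier}
                      (p-vanish : ∀ x → x ∉ support → p x ≈ 0#)
                      (∈-own-orbit : ∀ {x} → x ∈ support → x ∈ orbit x)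
                      (p-orbit-constant : ∀ {x y} → x ∈ support → y ∈ orbit x → p x ≈ p y)
                      (g : A → Bool) where

    average : A → Carrier
    average x = ∑ (orbit x) (λ y → mask (g y) (uniformOn (orbit x) y))

    private
      w : A → Carrier
      w x = recip (length (orbit x))

      h : A → Carrier
      h y = mask (g y) (p y)

      K : A → A → Carrier
      K x y = masked (orbit x) y (w x * h y)

      row-sum : ∀ {x} → x ∈ support → p x * average x ≈ ∑ support (K x)
      row-sum {x} x∈ = begin
        p x * average x                                              ≈⟨ ∑-*ˡ (orbit x) (p x) _ ⟩
        ∑ (orbit x) (λ y → p x * mask (g y) (uniformOn (orbit x) y)) ≈⟨ ∑-cong (orbit x) entry ⟩
        ∑ (orbit x) (K x)                                            ≈⟨ ∑-reindex _≟_ (K x)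
          (orbit-unique x) support-unique (λ y y∉ → reflexive (masked-∉ _ y∉))
          (λ y y∉ → mask-zero _ (≈-trans (*-congˡ (mask-zero (g y) (p-vanish y y∉))) (zeroʳ _))) ⟩
        ∑ support (K x)                                              ∎
        where
        entry : ∀ y → y ∈ orbit x → p x * mask (g y) (uniformOn (orbit x) y) ≈ K x y
        entry y y∈ = begin
          p x * mask (g y) (uniformOn (orbit x) y) ≡⟨ cong (λ u → p x * mask (g y) u) (masked-∈ (w x) y∈) ⟩
          p x * mask (g y) (w x)                  ≈⟨ mask-*-comm (g y) (p x) (w x) ⟩
          w x * mask (g y) (p x)                  ≈⟨ *-congˡ (mask-cong (g y) (p-orbit-constant x∈ y∈)) ⟩
          w x * h y                               ≡⟨ sym (masked-∈ (w x * h y) y∈) ⟩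
          K x y                                   ∎

      K-transpose : ∀ {x y} → x ∈ support → y ∈ support →
                    K x y ≈ masked (orbit y) x (w y * mask (g y) (p x))
      K-transpose {x} {y} x∈ y∈ with y ∈? orbit x
      ... | yes y∈x = begin
        w x * h y              ≡⟨ cong (λ k → recip k * h y) (↭-length (orbit-↭ y∈x)) ⟩
        w y * h y              ≈⟨ *-congˡ (mask-cong (g y) (≈-sym (p-orbit-constant x∈ y∈x))) ⟩
        w y * mask (g y) (p x) ≡⟨ sym (masked-∈ _ (∈-resp-↭ (orbit-↭ y∈x) (∈-own-orbit x∈))) ⟩
        masked (orbit y) x (w y * mask (g y) (p x)) ∎
      ... | no y∉x =
        reflexive (sym (masked-∉ _ λ x∈y → y∉x (∈-resp-↭ (orbit-↭ x∈y) (∈-own-orbit y∈))))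

      column-sum : ∀ {y} → y ∈ support → ∑ support (λ x → K x y) ≈ h y
      column-sum {y} y∈ = begin
        ∑ support (λ x → K x y)                ≈⟨ ∑-cong support (λ x x∈ → K-transpose x∈ y∈) ⟩
        ∑ support G                            ≈⟨ ∑-reindex _≟_ G support-unique (orbit-unique y)
          (λ x x∉ → mask-zero _ (≈-trans (*-congˡ (mask-zero (g y) (p-vanish x x∉))) (zeroʳ _)))
          (λ x x∉ → reflexive (masked-∉ _ x∉)) ⟩
        ∑ (orbit y) G                          ≈⟨ ∑-cong (orbit y) (λ x x∈ → ≈-trans
          (reflexive (masked-∈ _ x∈)) (*-congˡ (mask-cong (g y) (≈-sym (p-orbit-constant y∈ x∈))))) ⟩
        ∑ (orbit y) (λ _ → w y * h y)          ≈⟨ ∑-const (orbit y) (w y * h y) ⟩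
        fromℕ (length (orbit y)) * (w y * h y) ≈⟨ ≈-sym (*-assoc _ _ _) ⟩
        (fromℕ (length (orbit y)) * w y) * h y ≈⟨ *-congʳ (recip-length (∈-own-orbit y∈)) ⟩
        1# * h y                               ≈⟨ *-identityˡ (h y) ⟩
        h y                                    ∎
        where
        G : A → Carrier
        G x = masked (orbit y) x (w y * mask (g y) (p x))

    ∑-orbit-average : ∑ support (λ y → mask (g y) (p y)) ≈ ∑ support (λ x → p x * average x)
    ∑-orbit-average = ≈-sym (begin
      ∑ support (λ x → p x * average x)         ≈⟨ ∑-cong support (λ x → row-sum) ⟩
      ∑ support (λ x → ∑ support (K x))         ≈⟨ ∑-swap support support K ⟩
      ∑ support (λ y → ∑ support (λ x → K x y)) ≈⟨ ∑-cong support (λ y → column-sum) ⟩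
      ∑ support h                               ∎)

module Distributions {c ℓ} (F : OrderedField c ℓ) where

  open OrderedField F using (*-nonneg) renaming (_≤_ to _≤ᶠ_)
  open WithField F
  open OrderedFieldProperties F
  open import Relation.Binary.Reasoning.Setoid setoid

  restrictsTo : ∀ {m} n → Tree (Fin n) → Tree (Fin m) → Bool
  restrictsTo n T S = does (≡-decMaybe (_≟T_ Fin._≟_) (restrict n S) (just T))

  module _ {m : ℕ} where

    open Uniform F (_≟ᵀ_ m)
    open import Data.List.Membership.DecPropositional (_≟ᵀ_ m) using (_∈?_)

    uniformDist : (xs : List (Tree (Fin m))) → Unique xs → All (RBL m) xs → ∀ {x} → x ∈ xs → Dist m
    uniformDist xs unique valid x∈ = record
      { prob        = uniformOn xs
      ; supp        = xs
      ; supp-unique = unique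
      ; supp-valid  = valid
      ; nonneg      = λ t → mask-nonneg (does (t ∈? xs)) (recip-nonneg (length xs))
      ; vanish      = λ _ t∉ → reflexive (masked-∉ _ t∉)
      ; total       = ≈-trans (∑-cong xs (λ _ t∈ → reflexive (masked-∈ _ t∈)))
                              (≈-trans (∑-const xs _) (recip-length x∈))
      }

    orbitDist : ∀ x → RBL m x → Dist m
    orbitDist x rx = uniformDist (orbit m (shape x)) (orbit-unique m (shape x))
      (All.tabulate (proj₁ ∘ orbit-sound m (shape x))) (orbit-complete m (shape x) rx ≅-refl)

    orbitDist-uniform : ∀ x (rx : RBL m x) → IsUniformOn (shape x) (orbitDist x rx)
    orbitDist-uniform x rx =
      (λ y z (ry , dy) (rz , dz) → reflexive (trans (masked-∈ _ (orbit-complete m _ ry dy))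
                                                    (sym (masked-∈ _ (orbit-complete m _ rz dz))))) ,
      (λ y _ ¬dy → reflexive (masked-∉ _ (¬dy ∘ proj₂ ∘ orbit-sound m _)))

    IsUniformOn⇒Exchangeable : ∀ {U} {P : Dist m} → IsUniformOn U P → Exchangeable P
    IsUniformOn⇒Exchangeable {U} {P} (equal , zero-off) σ t rt with t ∈? orbit m U
    ... | yes t∈ = equal _ _ (relabel-RBL σ rt , ≅-trans (shape-relabel σ t) dt) (rt , dt)
      where dt = proj₂ (orbit-sound m U t∈)
    ... | no t∉ = ≈-trans (zero-off _ (relabel-RBL σ rt) (t∉ ∘ orbit-complete m U rt ∘ ≅-trans σt≅t))
                          (≈-sym (zero-off t rt (t∉ ∘ orbit-complete m U rt)))
      where σt≅t = ≅-sym (shape-relabel σ t)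

    -- π n (orbitDist x rx), which does not depend on the proof rx
    orbitAverage : ∀ {n} → Tree (Fin m) → Vect n
    orbitAverage {n} x T =
      ∑ (orbit m (shape x)) (λ y → mask (restrictsTo n T y) (uniformOn (orbit m (shape x)) y))

    Exchangeable⇒orbit-constant : ∀ {p : Dist m} → Exchangeable p → ∀ {x y} → RBL m x →
                                  y ∈ orbit m (shape x) → prob p x ≈ prob p y
    Exchangeable⇒orbit-constant {p} exchangeable {x} {y} rx y∈
      with ry , dy ← orbit-sound m (shape x) y∈
      with σ , σy≡x ← same-shape⇒relabel ry rx dy
      = subst (λ z → prob p z ≈ prob p y) σy≡x (exchangeable σ y ry)

    Exchangeable⇒orbit-average : ∀ {p : Dist m} → Exchangeable p → ∀ n T →
                                 π n p T ≈ ∑ (supp p) (λ x → prob p x * orbitAverage x T)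
    Exchangeable⇒orbit-average {p} exchangeable n T =
      OrbitAverage.∑-orbit-average (orbit m ∘ shape) (orbit-unique m ∘ shape)
        (λ {x} y∈ → orbit-≅ m (≅-sym (proj₂ (orbit-sound m (shape x) y∈))))
        (supp-unique p) (vanish p) (λ {x} x∈ → orbit-complete m (shape x) (valid x∈) ≅-refl)
        (λ x∈ → Exchangeable⇒orbit-constant {p = p} exchangeable (valid x∈)) (restrictsTo n T)
      where
      valid : ∀ {x} → x ∈ supp p → RBL m x
      valid = All.lookup (supp-valid p)

  module _ {m : ℕ} {a} {I : Set a} (is : List I) (w : I → Carrier) (d : I → Dist m)
           (w-nonneg : ∀ i → i ∈ is → 0# ≤ᶠ w i) (w-total : ∑ is w ≈ 1#) where

    private
      supports : List (Tree (Fin m))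
      supports = deduplicate (_≟ᵀ_ m) (concatMap (supp ∘ d) is)

      ∉supports : ∀ {t i} → t ∉ supports → i ∈ is → t ∉ supp (d i)
      ∉supports t∉ i∈ t∈ = t∉ (∈-deduplicate⁺ (_≟ᵀ_ m) (∈-concatMap⁺ (supp ∘ d) (lose i∈ t∈)))

      ∑-supports : ∀ {i} (f : Tree (Fin m) → Carrier) → i ∈ is →
                   (∀ t → t ∉ supp (d i) → f t ≈ 0#) → ∑ supports f ≈ ∑ (supp (d i)) f
      ∑-supports f i∈ vanish-i = ∑-reindex (_≟ᵀ_ m) f (deduplicate-! (_≟ᵀ_ m) _) (supp-unique (d _))
        (λ t t∉ → vanish-i t (∉supports t∉ i∈)) vanish-i

      weighted-total : ∀ {i} → i ∈ is → ∑ supports (λ t → w i * prob (d i) t) ≈ w i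
      weighted-total {i} i∈ = begin
        ∑ supports (λ t → w i * prob (d i) t) ≈⟨ ≈-sym (∑-*ˡ supports (w i) (prob (d i))) ⟩
        w i * ∑ supports (prob (d i))         ≈⟨ *-congˡ (∑-supports (prob (d i)) i∈ (vanish (d i))) ⟩
        w i * ∑ (supp (d i)) (prob (d i))     ≈⟨ *-congˡ (total (d i)) ⟩
        w i * 1#                              ≈⟨ *-identityʳ (w i) ⟩
        w i                                   ∎

    mixture : Dist m
    mixture = record
      { prob        = λ t → ∑ is (λ i → w i * prob (d i) t)
      ; supp        = supports
      ; supp-unique = deduplicate-! (_≟ᵀ_ m) _
      ; supp-valid  = All.tabulate λ t∈ →
          let i , i∈ , t∈i = find (∈-concatMap⁻ (supp ∘ d) {is} (∈-deduplicate⁻ (_≟ᵀ_ m) _ t∈))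
          in All.lookup (supp-valid (d i)) t∈i
      ; nonneg      = λ t → ∑-nonneg is λ i i∈ → *-nonneg (w-nonneg i i∈) (nonneg (d i) t)
      ; vanish      = λ t t∉ → ∑-zero is λ i i∈ →
          ≈-trans (*-congˡ (vanish (d i) t (∉supports t∉ i∈))) (zeroʳ _)
      ; total       = begin
          ∑ supports (λ t → ∑ is (λ i → w i * prob (d i) t)) ≈⟨ ∑-swap supports is _ ⟩
          ∑ is (λ i → ∑ supports (λ t → w i * prob (d i) t)) ≈⟨ ∑-cong is (λ _ → weighted-total) ⟩
          ∑ is w                                             ≈⟨ w-total ⟩
          1#                                                 ∎
      }

    mixture-exchangeable : (∀ i → i ∈ is → Exchangeable (d i)) → Exchangeable mixture
    mixture-exchangeable exchangeable σ t rt = ∑-cong is λ i i∈ → *-congˡ (exchangeable i i∈ σ t rt)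

    π-mixture : ∀ n T → π n mixture T ≈ ∑ is (λ i → w i * π n (d i) T)
    π-mixture n T = begin
      ∑ supports (λ t → mask (E t) (∑ is (λ i → w i * prob (d i) t))) ≈⟨ ∑-cong supports (λ t _ →
        ≈-trans (mask-∑ (E t) is _) (∑-cong is λ i _ → mask-*ˡ (E t) (w i) _)) ⟩
      ∑ supports (λ t → ∑ is (λ i → w i * mask (E t) (prob (d i) t))) ≈⟨ ∑-swap supports is _ ⟩
      ∑ is (λ i → ∑ supports (λ t → w i * mask (E t) (prob (d i) t))) ≈⟨ ∑-cong is (λ i i∈ →
        ≈-trans (≈-sym (∑-*ˡ supports (w i) _))
                (*-congˡ (∑-supports _ i∈ λ t t∉ → mask-zero (E t) (vanish (d i) t t∉)))) ⟩
      ∑ is (λ i → w i * π n (d i) T)                                  ∎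
      where
      E : Tree (Fin m) → Bool
      E = restrictsTo n T

  Conv-mono : ∀ {n} {S S′ : Vect n → Set (c ⊔ ℓ)} → (∀ {s} → S s → S′ s) → ∀ {q} → Conv S q → Conv S′ q
  Conv-mono S⊆S′ (cs , components , weights , q≐) =
    cs , All.map (λ (0≤a , s∈S) → 0≤a , S⊆S′ s∈S) components , weights , q≐

  module _ (m n : ℕ) {q : Vect n} where

    EX⇒Conv : EX m n q → Conv (ShapeProj m n) q
    EX⇒Conv (p , exchangeable , q≐πp) =
      map atom (supp p) , Allₚ.map⁺ (All.tabulate atom-ok) ,
      ≈-trans (reflexive (cong sumL (sym (map-∘ {f = atom} (supp p))))) (total p) ,
      λ T rT → begin
        q T                                              ≈⟨ q≐πp T rT ⟩
        π n p T                                          ≈⟨ Exchangeable⇒orbit-average {p = p} exchangeable n T ⟩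
        ∑ (supp p) (λ x → prob p x * orbitAverage x T)  ≡⟨ cong sumL (map-∘ {f = atom} (supp p)) ⟩
        ∑ (map atom (supp p)) (λ (a , s) → a * s T)     ∎
      where
      atom : Tree (Fin m) → Carrier × Vect n
      atom x = prob p x , orbitAverage x
      atom-ok : ∀ {x} → x ∈ supp p → 0# ≤ᶠ prob p x × ShapeProj m n (orbitAverage x)
      atom-ok {x} x∈ = nonneg p x , shape x , trans (length-leaves-shape x) (↭-allFin⇒length (proj₂ rx)) ,
                       orbitDist x rx , orbitDist-uniform x rx , λ _ _ → ≈-refl
        where rx = All.lookup (supp-valid p) x∈

    ShapeProj⇒EX : ShapeProj m n q → EX m n q
    ShapeProj⇒EX (_ , _ , P , uniform , q≐πP) = P , IsUniformOn⇒Exchangeable {P = P} uniform , q≐πP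

    EX-convex : Conv (EX m n) q → EX m n q
    EX-convex (cs , components , weights , q≐) =
      mixture is w d w-nonneg w-total ,
      mixture-exchangeable is w d w-nonneg w-total (λ i _ → proj₁ (proj₂ (proj₂ (proj₂ i)))) ,
      λ T rT → begin
        q T                                     ≈⟨ q≐ T rT ⟩
        ∑ cs (λ (a , s) → a * s T)              ≡⟨ sym (∑-toList components _) ⟩
        ∑ is (λ i → w i * proj₂ (proj₁ i) T)    ≈⟨ ∑-cong is (λ i _ → *-congˡ (q≐πd i T rT)) ⟩
        ∑ is (λ i → w i * π n (d i) T)          ≈⟨ ≈-sym (π-mixture is w d w-nonneg w-total n T) ⟩
        π n (mixture is w d w-nonneg w-total) T ∎
      where
      is = All.toList components
      w : _ → Carrier
      w i = proj₁ (proj₁ i)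
      d : _ → Dist m
      d i = proj₁ (proj₂ (proj₂ i))
      q≐πd : ∀ i → proj₂ (proj₁ i) ≐ π n (d i)
      q≐πd i = proj₂ (proj₂ (proj₂ (proj₂ i)))
      w-nonneg : ∀ i → i ∈ is → 0# ≤ᶠ w i
      w-nonneg i _ = proj₁ (proj₂ i)
      w-total : ∑ is w ≈ 1#
      w-total = ≈-trans (reflexive (∑-toList components proj₁)) weights

lemma2p5 : ∀ {c ℓ} (F : OrderedField c ℓ) → let open WithField F in
    (m n : ℕ) → 2 ≤ n → n ≤ m →
    (q : Vect n) → EX m n q ⇔ Conv (ShapeProj m n) q
lemma2p5 F m n _ _ q = mk⇔ (EX⇒Conv m n) (EX-convex m n ∘ Conv-mono (ShapeProj⇒EX m n))
  where open Distributions F
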